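{- Let $G$ be a vertex decomposable graph such that $\mathrm{Shed}(G)$ is not a dominating set of $G$. Let $x\in\mathrm{Shed}(G)$, and let $H$ be the graph with vertex set $V(G)\cup\{x'\}$ ($x'$ a new vertex) and edge set $E(G)\cup\{\{x',y\}: y\in N[x]\}$. Then $H$ is vertex decomposable and $\mathrm{Shed}(H)$ is not a dominating set of $H$.
   Context: All graphs are finite and simple. For a graph $G=(V,E)$ and $x\in V$, $G\setminus x$ is the graph obtained by deleting $x$ and its incident edges; $N(x)$ is the set of neighbours of $x$, $N[x]=N(x)\cup\{x\}$, and $G\setminus N[x]$ is obtained by deleting all vertices of $N[x]$ and their incident edges. A graph is well-covered if all its maximal independent sets have the same cardinality. A graph $G$ is vertex decomposable if $G$ is well-covered and either (i) $G$ has no edges (possibly no vertices), or (ii) there is a vertex $x$ such that both $G\setminus x$ and $G\setminus N[x]$ are vertex decomposable. For a vertex decomposable graph $G$, $\mathrm{Shed}(G)$ is the set of vertices $x$ such that $G\setminus x$ and $G\setminus N[x]$ are both vertex decomposable. A set $D\subseteq V$ is dominating if every vertex of $V\setminus D$ is adjacent to a vertex of $D$. -}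

module Defs where

open import Data.Nat using (ℕ; suc)
open import Data.Bool using (Bool; true; false; _∨_)
open import Data.Fin using (Fin; zero; suc; _≟_)
open import Data.Fin.Subset using (Subset; _∈_; _∉_; _⊆_; _─_; _-_; ∣_∣; ⊤)
open import Data.Vec using (tabulate)
open import Data.Product using (Σ; _×_; ∃)
open import Relation.Nullary using (¬_; does)
open import Relation.Binary.PropositionalEquality using (_≡_)

-- Induced subgraphs (obtained by deleting vertices) are represented by
-- their vertex set S : Subset n, keeping the ambient adjacency.
record Graph (n : ℕ) : Set where
  field
    adj    : Fin n → Fin n → Bool
    sym    : ∀ u v → adj u v ≡ adj v u
    irrefl : ∀ u → adj u u ≡ false
open Graph public

module _ {n : ℕ} (G : Graph n) where

  closedNbhd : Fin n → Subset n
  closedNbhd x = tabulate (λ y → does (y ≟ x) ∨ adj G x y)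

  Independent : Subset n → Subset n → Set
  Independent S I = I ⊆ S × (∀ u v → u ∈ I → v ∈ I → adj G u v ≡ false)

  MaximalIndependent : Subset n → Subset n → Set
  MaximalIndependent S I =
    Independent S I × (∀ J → Independent S J → I ⊆ J → J ⊆ I)

  WellCovered : Subset n → Set
  WellCovered S = ∀ I J → MaximalIndependent S I → MaximalIndependent S J
                  → ∣ I ∣ ≡ ∣ J ∣

  Edgeless : Subset n → Set
  Edgeless S = ∀ u v → u ∈ S → v ∈ S → adj G u v ≡ false

  -- vertex decomposability of the induced subgraph on S
  -- (G \ x  is  S - x ;  G \ N[x]  is  S ─ N[x])
  data VertexDecomposable (S : Subset n) : Set where
    vd-edgeless : WellCovered S → Edgeless S → VertexDecomposable S
    vd-shed     : WellCovered S → (x : Fin n) → x ∈ S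
                → VertexDecomposable (S - x)
                → VertexDecomposable (S ─ closedNbhd x)
                → VertexDecomposable S

  Shed : Subset n → Fin n → Set
  Shed S x = x ∈ S × VertexDecomposable (S - x)
                   × VertexDecomposable (S ─ closedNbhd x)

  Dominating : Subset n → (Fin n → Set) → Set
  Dominating S P = ∀ v → v ∈ S → ¬ P v → ∃ λ u → P u × adj G u v ≡ true

  VD : Set
  VD = VertexDecomposable ⊤

  ShedG : Fin n → Set
  ShedG = Shed ⊤

-- The graph H: new vertex x' = zero, old vertex v becomes suc v;
-- x' is joined to every vertex of N[x].
addAdj : ∀ {n} → Graph n → Fin n → Fin (suc n) → Fin (suc n) → Bool
addAdj G x zero    zero    = false
addAdj G x zero    (suc y) = does (y ≟ x) ∨ adj G x y
addAdj G x (suc y) zero    = does (y ≟ x) ∨ adj G x y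
addAdj G x (suc u) (suc v) = adj G u v

addSym : ∀ {n} (G : Graph n) (x : Fin n) u v → addAdj G x u v ≡ addAdj G x v u
addSym G x zero    zero    = Relation.Binary.PropositionalEquality.refl
addSym G x zero    (suc y) = Relation.Binary.PropositionalEquality.refl
addSym G x (suc y) zero    = Relation.Binary.PropositionalEquality.refl
addSym G x (suc u) (suc v) = sym G u v

addIrrefl : ∀ {n} (G : Graph n) (x : Fin n) u → addAdj G x u u ≡ false
addIrrefl G x zero    = Relation.Binary.PropositionalEquality.refl
addIrrefl G x (suc u) = irrefl G u

addClosedNbhdVertex : ∀ {n} → Graph n → Fin n → Graph (suc n)
addClosedNbhdVertex G x = record
  { adj = addAdj G x ; sym = addSym G x ; irrefl = addIrrefl G x }

-- x′ and x are adjacent twins in H (equal closed neighbourhoods).  Shedding x′ leaves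
-- H ∖ x′ = G and H ∖ N[x′] = G ∖ N[x], both vertex decomposable as x ∈ Shed(G), and H is
-- well-covered because a maximal independent set containing x′ may trade it for x.
-- Conversely, deleting one of two adjacent twins preserves vertex decomposability (when the
-- shedding vertex is the other twin, transport along the automorphism exchanging them), so
-- every w ≠ x in Shed(H) lies in Shed(G); and x dominates whatever x′ dominates in G.  Hence
-- if Shed(H) dominated H, Shed(G) would dominate G.

module Submission where

open import Defs hiding (sym)
open import Data.Nat using (suc)
open import Data.Bool using (true; false; _∧_; _∨_; not)
open import Data.Bool.Properties using (∧-identityʳ; ∧-zeroʳ; ¬-not) renaming (_≟_ to _≟ᵇ_)
open import Data.Fin using (Fin; zero; suc; _≟_)
open import Data.Fin.Properties using (any?; suc-injective)
open import Data.Fin.Permutation.Components using (transpose)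
open import Data.Fin.Subset using (Subset; _∈_; _∉_; _⊆_; _─_; _-_; _∪_; ∣_∣; ⊤; ⁅_⁆)
open import Data.Fin.Subset.Properties
  using ( _∈?_; ∈⊤; x∈⁅x⁆; x∈⁅y⁆⇒x≡y; p⊆p∪q; x∈p∪q⁺; x∈p∪q⁻; drop-there; drop-∷-⊆; p─⊥≡p; p─q⊆p
        ; x∈p∧x≢y⇒x∈p-y; x∈p∧x∉q⇒x∈p─q; p─x─y≡p─y─x; p─q─r≡p─r─q )
open import Data.Product using (∃; _×_; _,_; proj₁; proj₂)
open import Data.Sum using (inj₁; inj₂)
open import Data.Vec using (_∷_; here; there; lookup; tabulate; tail)
open import Data.Vec.Properties
  using (lookup∘tabulate; tabulate∘lookup; tabulate-cong; lookup-replicate; []=⇒lookup; lookup⇒[]=)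
open import Function using (_∘_)
open import Function.Bundles using (mk⇔)
open import Relation.Binary.PropositionalEquality
open import Relation.Nullary using (¬_; Dec; yes; no; does; contradiction)
open import Relation.Nullary.Decidable using (_×-dec_; dec-true; dec-false; does-⇔)

Subset-ext : ∀ {m} {p q : Subset m} → (∀ i → lookup p i ≡ lookup q i) → p ≡ q
Subset-ext {p = p} {q} p≗q =
  trans (sym (tabulate∘lookup p)) (trans (tabulate-cong p≗q) (tabulate∘lookup q))

lookup-─ : ∀ {m} (p q : Subset m) i → lookup (p ─ q) i ≡ lookup p i ∧ not (lookup q i)
lookup-─ (s ∷ p) (false ∷ q) zero    = sym (∧-identityʳ s)
lookup-─ (s ∷ p) (true  ∷ q) zero    = sym (∧-zeroʳ s)
lookup-─ (s ∷ p) (t     ∷ q) (suc i) = lookup-─ p q i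

lookup-⁅⁆ : ∀ {m} (x i : Fin m) → lookup ⁅ x ⁆ i ≡ does (i ≟ x)
lookup-⁅⁆ zero    zero    = refl
lookup-⁅⁆ zero    (suc i) = lookup-replicate i false
lookup-⁅⁆ (suc x) zero    = refl
lookup-⁅⁆ (suc x) (suc i) = lookup-⁅⁆ x i

∣p∣≡1+∣p-x∣ : ∀ {m} {p : Subset m} {x} → x ∈ p → ∣ p ∣ ≡ suc ∣ p - x ∣
∣p∣≡1+∣p-x∣ {p = true  ∷ p} here        = cong (suc ∘ ∣_∣) (sym (p─⊥≡p p))
∣p∣≡1+∣p-x∣ {p = false ∷ p} (there x∈p) = ∣p∣≡1+∣p-x∣ x∈p
∣p∣≡1+∣p-x∣ {p = true  ∷ p} (there x∈p) = cong suc (∣p∣≡1+∣p-x∣ x∈p)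

lookup-closedNbhd : ∀ {m} (K : Graph m) w i → lookup (closedNbhd K w) i ≡ does (i ≟ w) ∨ adj K w i
lookup-closedNbhd K w = lookup∘tabulate (λ y → does (y ≟ w) ∨ adj K w y)

lookup≡true⇒∈ : ∀ {m} {p : Subset m} {i} → lookup p i ≡ true → i ∈ p
lookup≡true⇒∈ {p = p} {i} = lookup⇒[]= i p

∉⇒lookup≡false : ∀ {m} {p : Subset m} {i} → i ∉ p → lookup p i ≡ false
∉⇒lookup≡false i∉p = ¬-not (i∉p ∘ lookup≡true⇒∈)

lookup-remove : ∀ {m} (p : Subset m) x i → lookup (p - x) i ≡ lookup p i ∧ not (does (i ≟ x))
lookup-remove p x i = trans (lookup-─ p ⁅ x ⁆ i) (cong (λ b → lookup p i ∧ not b) (lookup-⁅⁆ x i))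

x∈p─q⇒x∉q : ∀ {m} {p q : Subset m} {x} → x ∈ p ─ q → x ∉ q
x∈p─q⇒x∉q {p = s ∷ p} {false ∷ q} here ()
x∈p─q⇒x∉q {p = s ∷ p} {t ∷ q} (there x∈p─q) (there x∈q) = x∈p─q⇒x∉q x∈p─q x∈q

x∈p-y⇒x≢y : ∀ {m} {p : Subset m} {x y} → x ∈ p - y → x ≢ y
x∈p-y⇒x≢y x∈p-y refl = x∈p─q⇒x∉q x∈p-y (x∈⁅x⁆ _)

x∉p⇒p-x≡p : ∀ {m} {p : Subset m} {x} → x ∉ p → p - x ≡ p
x∉p⇒p-x≡p {p = p} {x} x∉p = Subset-ext λ i → trans (lookup-remove p x i) (unchanged i)
  where
  unchanged : ∀ i → lookup p i ∧ not (does (i ≟ x)) ≡ lookup p i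
  unchanged i with i ≟ x
  ... | yes refl rewrite ∉⇒lookup≡false x∉p = refl
  ... | no  _    = ∧-identityʳ _

module _ {m} (K : Graph m) where

  maximal⇒dominating : ∀ {S I} → MaximalIndependent K S I → Dominating K S (_∈ I)
  maximal⇒dominating {S} {I} ((I⊆S , I-indep) , maximal) v v∈S v∉I
    with any? (λ u → u ∈? I ×-dec adj K u v ≟ᵇ true)
  ... | yes dominated   = dominated
  ... | no  undominated =
    contradiction (maximal (I ∪ ⁅ v ⁆) (J⊆S , J-indep) (p⊆p∪q _) (x∈p∪q⁺ (inj₂ (x∈⁅x⁆ v)))) v∉I
    where
    nonadjacent : ∀ {u} → u ∈ I → adj K u v ≡ false
    nonadjacent u∈I = ¬-not (λ u~v → undominated (_ , u∈I , u~v))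
    J⊆S : I ∪ ⁅ v ⁆ ⊆ S
    J⊆S u∈J with x∈p∪q⁻ I _ u∈J
    ... | inj₁ u∈I = I⊆S u∈I
    ... | inj₂ u∈v rewrite x∈⁅y⁆⇒x≡y v u∈v = v∈S
    J-indep : ∀ u w → u ∈ I ∪ ⁅ v ⁆ → w ∈ I ∪ ⁅ v ⁆ → adj K u w ≡ false
    J-indep u w u∈J w∈J with x∈p∪q⁻ I _ u∈J | x∈p∪q⁻ I _ w∈J
    ... | inj₁ u∈I | inj₁ w∈I = I-indep u w u∈I w∈I
    ... | inj₁ u∈I | inj₂ w∈v rewrite x∈⁅y⁆⇒x≡y v w∈v = nonadjacent u∈I
    ... | inj₂ u∈v | inj₁ w∈I rewrite x∈⁅y⁆⇒x≡y v u∈v = trans (Graph.sym K v w) (nonadjacent w∈I)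
    ... | inj₂ u∈v | inj₂ w∈v rewrite x∈⁅y⁆⇒x≡y v u∈v | x∈⁅y⁆⇒x≡y v w∈v = irrefl K v

  dominating⇒maximal : ∀ {S I} → Independent K S I → Dominating K S (_∈ I)
                     → MaximalIndependent K S I
  dominating⇒maximal {S} {I} I-indep dominating = I-indep , maximal
    where
    maximal : ∀ J → Independent K S J → I ⊆ J → J ⊆ I
    maximal J (J⊆S , J-indep) I⊆J {v} v∈J with v ∈? I
    ... | yes v∈I = v∈I
    ... | no  v∉I with dominating v (J⊆S v∈J) v∉I
    ... | u , u∈I , u~v with () ← trans (sym u~v) (J-indep u v (I⊆J u∈I) v∈J)

  wellCovered-transfer : ∀ {S S′}
    → (∀ {I} → MaximalIndependent K S I → ∃ λ J → MaximalIndependent K S′ J × ∣ J ∣ ≡ ∣ I ∣)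
    → WellCovered K S′ → WellCovered K S
  wellCovered-transfer f S′-wc I₁ I₂ I₁-max I₂-max with f I₁-max | f I₂-max
  ... | J₁ , J₁-max , ∣J₁∣≡∣I₁∣ | J₂ , J₂-max , ∣J₂∣≡∣I₂∣ =
    trans (sym ∣J₁∣≡∣I₁∣) (trans (S′-wc J₁ J₂ J₁-max J₂-max) ∣J₂∣≡∣I₂∣)

  vd⇒wellCovered : ∀ {S} → VertexDecomposable K S → WellCovered K S
  vd⇒wellCovered (vd-edgeless wc _)   = wc
  vd⇒wellCovered (vd-shed wc _ _ _ _) = wc

module Transposition {m} (i j : Fin m) where

  transpose-matchˡ : transpose i j i ≡ j
  transpose-matchˡ rewrite dec-true (i ≟ i) refl = refl

  transpose-matchʳ : transpose i j j ≡ i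
  transpose-matchʳ with j ≟ i
  ... | yes refl = refl
  ... | no  _    rewrite dec-true (j ≟ j) refl = refl

  transpose-mismatch : ∀ {k} → k ≢ i → k ≢ j → transpose i j k ≡ k
  transpose-mismatch {k} k≢i k≢j rewrite dec-false (k ≟ i) k≢i | dec-false (k ≟ j) k≢j = refl

  data Position (k : Fin m) : Set where
    at-i      : k ≡ i → Position k
    at-j      : k ≡ j → Position k
    elsewhere : k ≢ i → k ≢ j → Position k

  position : ∀ k → Position k
  position k with k ≟ i | k ≟ j
  ... | yes k≡i | _       = at-i k≡i
  ... | no  _   | yes k≡j = at-j k≡j
  ... | no  k≢i | no  k≢j = elsewhere k≢i k≢j

  transpose-involutive : ∀ k → transpose i j (transpose i j k) ≡ k
  transpose-involutive k with position k
  ... | at-i refl = trans (cong (transpose i j) transpose-matchˡ) transpose-matchʳ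
  ... | at-j refl = trans (cong (transpose i j) transpose-matchʳ) transpose-matchˡ
  ... | elsewhere k≢i k≢j =
    trans (cong (transpose i j) (transpose-mismatch k≢i k≢j)) (transpose-mismatch k≢i k≢j)

module Twins {m} (K : Graph m) (a b : Fin m)
  (twins : ∀ w → w ≢ a → w ≢ b → adj K a w ≡ adj K b w) where

  open Transposition a b
  open ≡-Reasoning

  swap : Fin m → Fin m
  swap = transpose a b

  adj-swapˡ : ∀ u {v} → v ≢ a → v ≢ b → adj K (swap u) v ≡ adj K u v
  adj-swapˡ u v≢a v≢b with position u
  ... | at-i refl rewrite transpose-matchˡ = sym (twins _ v≢a v≢b)
  ... | at-j refl rewrite transpose-matchʳ = twins _ v≢a v≢b
  ... | elsewhere u≢a u≢b rewrite transpose-mismatch u≢a u≢b = refl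

  adj-swap : ∀ u v → adj K (swap u) (swap v) ≡ adj K u v
  adj-swap u v with position u | position v
  ... | elsewhere u≢a u≢b | _ = begin
    adj K (swap u) (swap v) ≡⟨ cong (λ w → adj K w (swap v)) (transpose-mismatch u≢a u≢b) ⟩
    adj K u (swap v)        ≡⟨ Graph.sym K u (swap v) ⟩
    adj K (swap v) u        ≡⟨ adj-swapˡ v u≢a u≢b ⟩
    adj K v u               ≡⟨ Graph.sym K v u ⟩
    adj K u v               ∎
  ... | _ | elsewhere v≢a v≢b rewrite transpose-mismatch v≢a v≢b = adj-swapˡ u v≢a v≢b
  ... | at-i refl | at-i refl rewrite transpose-matchˡ = trans (irrefl K b) (sym (irrefl K a))
  ... | at-j refl | at-j refl rewrite transpose-matchʳ = trans (irrefl K a) (sym (irrefl K b))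
  ... | at-i refl | at-j refl rewrite transpose-matchˡ | transpose-matchʳ = Graph.sym K b a
  ... | at-j refl | at-i refl rewrite transpose-matchˡ | transpose-matchʳ = Graph.sym K a b

  swap-≟ : ∀ i z → does (swap i ≟ z) ≡ does (i ≟ swap z)
  swap-≟ i z = does-⇔
    (mk⇔ (λ e → trans (sym (transpose-involutive i)) (cong swap e))
         (λ e → trans (cong swap e) (transpose-involutive z)))
    (swap i ≟ z) (i ≟ swap z)

  image : Subset m → Subset m
  image S = tabulate (lookup S ∘ swap)

  lookup-image : ∀ S i → lookup (image S) i ≡ lookup S (swap i)
  lookup-image S = lookup∘tabulate (lookup S ∘ swap)

  ∈-image⁺ : ∀ {S i} → swap i ∈ S → i ∈ image S
  ∈-image⁺ {S} {i} si∈S = lookup≡true⇒∈ (trans (lookup-image S i) ([]=⇒lookup si∈S))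

  ∈-image⁻ : ∀ {S i} → i ∈ image S → swap i ∈ S
  ∈-image⁻ {S} {i} i∈S′ = lookup≡true⇒∈ (trans (sym (lookup-image S i)) ([]=⇒lookup i∈S′))

  swap-∈-image : ∀ {S i} → i ∈ S → swap i ∈ image S
  swap-∈-image {S} i∈S = ∈-image⁺ (subst (_∈ S) (sym (transpose-involutive _)) i∈S)

  image-involutive : ∀ S → image (image S) ≡ S
  image-involutive S = Subset-ext λ i → begin
    lookup (image (image S)) i ≡⟨ lookup-image (image S) i ⟩
    lookup (image S) (swap i)  ≡⟨ lookup-image S (swap i) ⟩
    lookup S (swap (swap i))   ≡⟨ cong (lookup S) (transpose-involutive i) ⟩
    lookup S i                 ∎

  image-─ : ∀ S R → image (S ─ R) ≡ image S ─ image R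
  image-─ S R = Subset-ext λ i → begin
    lookup (image (S ─ R)) i                       ≡⟨ lookup-image (S ─ R) i ⟩
    lookup (S ─ R) (swap i)                        ≡⟨ lookup-─ S R (swap i) ⟩
    lookup S (swap i) ∧ not (lookup R (swap i))
      ≡⟨ cong₂ (λ s r → s ∧ not r) (lookup-image S i) (lookup-image R i) ⟨
    lookup (image S) i ∧ not (lookup (image R) i)  ≡⟨ lookup-─ (image S) (image R) i ⟨
    lookup (image S ─ image R) i                   ∎

  image-⁅⁆ : ∀ z → image ⁅ z ⁆ ≡ ⁅ swap z ⁆
  image-⁅⁆ z = Subset-ext λ i → begin
    lookup (image ⁅ z ⁆) i   ≡⟨ lookup-image ⁅ z ⁆ i ⟩
    lookup ⁅ z ⁆ (swap i)    ≡⟨ lookup-⁅⁆ z (swap i) ⟩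
    does (swap i ≟ z)        ≡⟨ swap-≟ i z ⟩
    does (i ≟ swap z)        ≡⟨ sym (lookup-⁅⁆ (swap z) i) ⟩
    lookup ⁅ swap z ⁆ i      ∎

  image-closedNbhd : ∀ z → image (closedNbhd K z) ≡ closedNbhd K (swap z)
  image-closedNbhd z = Subset-ext pointwise
    where
    pointwise : ∀ i → lookup (image (closedNbhd K z)) i ≡ lookup (closedNbhd K (swap z)) i
    pointwise i = begin
      lookup (image (closedNbhd K z)) i       ≡⟨ lookup-image (closedNbhd K z) i ⟩
      lookup (closedNbhd K z) (swap i)        ≡⟨ lookup-closedNbhd K z (swap i) ⟩
      does (swap i ≟ z) ∨ adj K z (swap i)    ≡⟨ cong₂ _∨_ (swap-≟ i z) (sym adj-swap-z) ⟩
      does (i ≟ swap z) ∨ adj K (swap z) i    ≡⟨ sym (lookup-closedNbhd K (swap z) i) ⟩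
      lookup (closedNbhd K (swap z)) i        ∎
      where
      adj-swap-z : adj K (swap z) i ≡ adj K z (swap i)
      adj-swap-z = trans (cong (adj K (swap z)) (sym (transpose-involutive i))) (adj-swap z (swap i))

  image-remove : ∀ S z → image (S - z) ≡ image S - swap z
  image-remove S z = trans (image-─ S ⁅ z ⁆) (cong (image S ─_) (image-⁅⁆ z))

  image-─closedNbhd : ∀ S z → image (S ─ closedNbhd K z) ≡ image S ─ closedNbhd K (swap z)
  image-─closedNbhd S z = trans (image-─ S (closedNbhd K z)) (cong (image S ─_) (image-closedNbhd z))

  image-fixed : ∀ {S} → lookup S a ≡ lookup S b → image S ≡ S
  image-fixed {S} Sa≡Sb = Subset-ext λ i → trans (lookup-image S i) (fixed i)
    where
    fixed : ∀ i → lookup S (swap i) ≡ lookup S i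
    fixed i with position i
    ... | at-i refl rewrite transpose-matchˡ = sym Sa≡Sb
    ... | at-j refl rewrite transpose-matchʳ = Sa≡Sb
    ... | elsewhere i≢a i≢b = cong (lookup S) (transpose-mismatch i≢a i≢b)

  ∣image∣-byDeletion : ∀ {S z} → z ∈ S → image (S - z) ≡ S - z → ∣ image S ∣ ≡ ∣ S ∣
  ∣image∣-byDeletion {S} {z} z∈S fixed = begin
    ∣ image S ∣               ≡⟨ ∣p∣≡1+∣p-x∣ (swap-∈-image z∈S) ⟩
    suc ∣ image S - swap z ∣  ≡⟨ cong (suc ∘ ∣_∣) (image-remove S z) ⟨
    suc ∣ image (S - z) ∣     ≡⟨ cong (suc ∘ ∣_∣) fixed ⟩
    suc ∣ S - z ∣             ≡⟨ ∣p∣≡1+∣p-x∣ z∈S ⟨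
    ∣ S ∣                     ∎

  ∣image∣ : ∀ S → ∣ image S ∣ ≡ ∣ S ∣
  ∣image∣ S with lookup S a in Sa | lookup S b in Sb
  ... | true  | true  = cong ∣_∣ (image-fixed {S} (trans Sa (sym Sb)))
  ... | false | false = cong ∣_∣ (image-fixed {S} (trans Sa (sym Sb)))
  ... | true  | false = ∣image∣-byDeletion {S} (lookup≡true⇒∈ Sa) (image-fixed {S - a} S-a-fixed)
    where
    S-a-fixed : lookup (S - a) a ≡ lookup (S - a) b
    S-a-fixed rewrite lookup-remove S a a | lookup-remove S a b | dec-true (a ≟ a) refl | Sb = ∧-zeroʳ _
  ... | false | true  = ∣image∣-byDeletion {S} (lookup≡true⇒∈ Sb) (image-fixed {S - b} S-b-fixed)
    where
    S-b-fixed : lookup (S - b) a ≡ lookup (S - b) b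
    S-b-fixed rewrite lookup-remove S b a | lookup-remove S b b | dec-true (b ≟ b) refl | Sa = sym (∧-zeroʳ _)

  independent-image : ∀ {S I} → Independent K S I → Independent K (image S) (image I)
  independent-image (I⊆S , I-indep) =
    (∈-image⁺ ∘ I⊆S ∘ ∈-image⁻) ,
    λ u v u∈ v∈ → trans (sym (adj-swap u v)) (I-indep _ _ (∈-image⁻ u∈) (∈-image⁻ v∈))

  dominating-image : ∀ {S I} → Dominating K S (_∈ I) → Dominating K (image S) (_∈ image I)
  dominating-image {I = I} dominating v v∈S′ v∉I′
    with dominating (swap v) (∈-image⁻ v∈S′) (v∉I′ ∘ ∈-image⁺)
  ... | u , u∈I , u~sv = swap u , swap-∈-image u∈I , (begin
    adj K (swap u) v               ≡⟨ cong (adj K (swap u)) (transpose-involutive v) ⟨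
    adj K (swap u) (swap (swap v)) ≡⟨ adj-swap u (swap v) ⟩
    adj K u (swap v)               ≡⟨ u~sv ⟩
    true                           ∎)

  maximal-image : ∀ {S I} → MaximalIndependent K S I → MaximalIndependent K (image S) (image I)
  maximal-image I-max = dominating⇒maximal K (independent-image (proj₁ I-max))
                                            (dominating-image (maximal⇒dominating K I-max))

  wellCovered-image : ∀ {S} → WellCovered K S → WellCovered K (image S)
  wellCovered-image {S} = wellCovered-transfer K λ {I} I-max →
    image I , subst (λ T → MaximalIndependent K T (image I)) (image-involutive S) (maximal-image I-max) ,
    ∣image∣ I

  edgeless-image : ∀ {S} → Edgeless K S → Edgeless K (image S)
  edgeless-image edgeless u v u∈ v∈ =
    trans (sym (adj-swap u v)) (edgeless _ _ (∈-image⁻ u∈) (∈-image⁻ v∈))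

  vd-image : ∀ {S} → VertexDecomposable K S → VertexDecomposable K (image S)
  vd-image (vd-edgeless wc edgeless) = vd-edgeless (wellCovered-image wc) (edgeless-image edgeless)
  vd-image {S} (vd-shed wc z z∈S vd-S-z vd-S─Nz) =
    vd-shed (wellCovered-image wc) (swap z) (swap-∈-image z∈S)
      (subst (VertexDecomposable K) (image-remove S z) (vd-image vd-S-z))
      (subst (VertexDecomposable K) (image-─closedNbhd S z) (vd-image vd-S─Nz))

module AdjacentTwins {m} (K : Graph m) {a b : Fin m} (a≢b : a ≢ b) (a~b : adj K a b ≡ true)
  (twins : ∀ w → w ≢ a → w ≢ b → adj K a w ≡ adj K b w) where

  open Twins K a b twins
  open Transposition a b using (transpose-matchˡ; transpose-matchʳ; position; at-i; at-j; elsewhere)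

  adj-twinsʳ : ∀ {u} → u ≢ a → u ≢ b → adj K u a ≡ adj K u b
  adj-twinsʳ {u} u≢a u≢b =
    trans (Graph.sym K u a) (trans (twins u u≢a u≢b) (Graph.sym K b u))

  b∈closedNbhd⇒a∈closedNbhd : ∀ {z} → z ≢ a → z ≢ b → b ∈ closedNbhd K z → a ∈ closedNbhd K z
  b∈closedNbhd⇒a∈closedNbhd {z} z≢a z≢b b∈Nz = lookup≡true⇒∈ (begin
    lookup (closedNbhd K z) a  ≡⟨ lookup-closedNbhd K z a ⟩
    does (a ≟ z) ∨ adj K z a   ≡⟨ cong₂ _∨_ (dec-false (a ≟ z) (z≢a ∘ sym)) (adj-twinsʳ z≢a z≢b) ⟩
    false ∨ adj K z b          ≡⟨ cong (_∨ adj K z b) (dec-false (b ≟ z) (z≢b ∘ sym)) ⟨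
    does (b ≟ z) ∨ adj K z b   ≡⟨ lookup-closedNbhd K z b ⟨
    lookup (closedNbhd K z) b  ≡⟨ []=⇒lookup b∈Nz ⟩
    true                       ∎)
    where open ≡-Reasoning

  maximal[T-a]⇒maximal[T] : ∀ {T I} → b ∈ T → MaximalIndependent K (T - a) I
                          → MaximalIndependent K T I
  maximal[T-a]⇒maximal[T] {T} {I} b∈T I-max@((I⊆T-a , I-indep) , _) =
    dominating⇒maximal K (p─q⊆p T ⁅ a ⁆ ∘ I⊆T-a , I-indep) dominating
    where
    dominating : Dominating K T (_∈ I)
    dominating v v∈T v∉I with v ≟ a
    ... | no v≢a = maximal⇒dominating K I-max v (x∈p∧x≢y⇒x∈p-y v∈T v≢a) v∉I
    ... | yes refl with b ∈? I
    ...   | yes b∈I = b , b∈I , trans (Graph.sym K b a) a~b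
    ...   | no  b∉I with maximal⇒dominating K I-max b (x∈p∧x≢y⇒x∈p-y b∈T (a≢b ∘ sym)) b∉I
    ...     | u , u∈I , u~b =
      u , u∈I , trans (adj-twinsʳ (x∈p-y⇒x≢y (I⊆T-a u∈I)) (λ { refl → b∉I u∈I })) u~b

  maximal[T]⇒maximal[T-a] : ∀ {T I} → a ∉ I → MaximalIndependent K T I
                          → MaximalIndependent K (T - a) I
  maximal[T]⇒maximal[T-a] {T} {I} a∉I I-max@((I⊆T , I-indep) , _) =
    dominating⇒maximal K (I⊆T-a , I-indep)
      (λ v v∈T-a → maximal⇒dominating K I-max v (p─q⊆p T ⁅ a ⁆ v∈T-a))
    where
    I⊆T-a : I ⊆ T - a
    I⊆T-a {i} i∈I = x∈p∧x≢y⇒x∈p-y (I⊆T i∈I) λ { refl → a∉I i∈I }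

  maximal[T]⇒∃maximal[T-a] : ∀ {T I} → a ∈ T → b ∈ T → MaximalIndependent K T I
                           → ∃ λ J → MaximalIndependent K (T - a) J × ∣ J ∣ ≡ ∣ I ∣
  maximal[T]⇒∃maximal[T-a] {T} {I} a∈T b∈T I-max with a ∈? I
  ... | no  a∉I = I , maximal[T]⇒maximal[T-a] a∉I I-max , refl
  ... | yes a∈I = image I , maximal[T]⇒maximal[T-a] a∉I′ I′-max , ∣image∣ I
    where
    I′-max : MaximalIndependent K T (image I)
    I′-max = subst (λ S → MaximalIndependent K S (image I))
                   (image-fixed (trans ([]=⇒lookup a∈T) (sym ([]=⇒lookup b∈T))))
                   (maximal-image I-max)
    a∉I′ : a ∉ image I
    a∉I′ a∈I′ with () ← trans (sym a~b)
      (proj₂ (proj₁ I-max) a b a∈I (subst (_∈ I) transpose-matchˡ (∈-image⁻ a∈I′)))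

  wellCovered[T]⇒wellCovered[T-a] : ∀ {T} → b ∈ T → WellCovered K T → WellCovered K (T - a)
  wellCovered[T]⇒wellCovered[T-a] b∈T =
    wellCovered-transfer K λ {I} I-max → I , maximal[T-a]⇒maximal[T] b∈T I-max , refl

  wellCovered[T-a]⇒wellCovered[T] : ∀ {T} → a ∈ T → b ∈ T → WellCovered K (T - a) → WellCovered K T
  wellCovered[T-a]⇒wellCovered[T] a∈T b∈T = wellCovered-transfer K (maximal[T]⇒∃maximal[T-a] a∈T b∈T)

  vd[T]⇒vd[T-a] : ∀ {T} → a ∈ T → b ∈ T → VertexDecomposable K T → VertexDecomposable K (T - a)
  vd[T]⇒vd[T-a] a∈T b∈T (vd-edgeless wc edgeless) =
    vd-edgeless (wellCovered[T]⇒wellCovered[T-a] b∈T wc)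
                (λ u v u∈ v∈ → edgeless u v (p─q⊆p _ _ u∈) (p─q⊆p _ _ v∈))
  vd[T]⇒vd[T-a] {T} a∈T b∈T (vd-shed wc z z∈T vd-T-z vd-T─Nz) with position z
  ... | at-i refl = vd-T-z
  ... | at-j refl = subst (VertexDecomposable K) T-b≅T-a (vd-image vd-T-z)
    where
    T-b≅T-a : image (T - b) ≡ T - a
    T-b≅T-a = begin
      image (T - b)       ≡⟨ image-remove T b ⟩
      image T - swap b    ≡⟨ cong₂ _-_ (image-fixed (trans ([]=⇒lookup a∈T) (sym ([]=⇒lookup b∈T))))
                                       transpose-matchʳ ⟩
      T - a               ∎
      where open ≡-Reasoning
  ... | elsewhere z≢a z≢b =
    vd-shed (wellCovered[T]⇒wellCovered[T-a] b∈T wc) z (x∈p∧x≢y⇒x∈p-y z∈T z≢a)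
      (subst (VertexDecomposable K) (p─x─y≡p─y─x T z a)
        (vd[T]⇒vd[T-a] (x∈p∧x≢y⇒x∈p-y a∈T (z≢a ∘ sym)) (x∈p∧x≢y⇒x∈p-y b∈T (z≢b ∘ sym))
                       vd-T-z))
      (subst (VertexDecomposable K) (p─q─r≡p─r─q T (closedNbhd K z) ⁅ a ⁆)
        (vd-T─Nz-a (a ∈? T ─ closedNbhd K z)))
    where
    vd-T─Nz-a : Dec (a ∈ T ─ closedNbhd K z) → VertexDecomposable K (T ─ closedNbhd K z - a)
    vd-T─Nz-a (no a∉T─Nz) = subst (VertexDecomposable K) (sym (x∉p⇒p-x≡p a∉T─Nz)) vd-T─Nz
    vd-T─Nz-a (yes a∈T─Nz) = vd[T]⇒vd[T-a] a∈T─Nz b∈T─Nz vd-T─Nz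
      where
      b∈T─Nz : b ∈ T ─ closedNbhd K z
      b∈T─Nz = x∈p∧x∉q⇒x∈p─q b∈T (x∈p─q⇒x∉q a∈T─Nz ∘ b∈closedNbhd⇒a∈closedNbhd z≢a z≢b)

module Extension {n} (G : Graph n) (H : Graph (suc n))
  (H-restricts : ∀ u v → adj H (suc u) (suc v) ≡ adj G u v) where

  false∷-─closedNbhd : ∀ S z → (false ∷ S) ─ closedNbhd H (suc z) ≡ false ∷ (S ─ closedNbhd G z)
  false∷-─closedNbhd S z = Subset-ext pointwise
    where
    open ≡-Reasoning
    nbhd : ∀ y → lookup (closedNbhd H (suc z)) (suc y) ≡ lookup (closedNbhd G z) y
    nbhd y = begin
      lookup (closedNbhd H (suc z)) (suc y)  ≡⟨ lookup-closedNbhd H (suc z) (suc y) ⟩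
      does (y ≟ z) ∨ adj H (suc z) (suc y)   ≡⟨ cong (does (y ≟ z) ∨_) (H-restricts z y) ⟩
      does (y ≟ z) ∨ adj G z y               ≡⟨ lookup-closedNbhd G z y ⟨
      lookup (closedNbhd G z) y              ∎
    pointwise : ∀ i → lookup ((false ∷ S) ─ closedNbhd H (suc z)) i
                    ≡ lookup (false ∷ (S ─ closedNbhd G z)) i
    pointwise zero    = lookup-─ (false ∷ S) (closedNbhd H (suc z)) zero
    pointwise (suc y) = begin
      lookup ((false ∷ S) ─ closedNbhd H (suc z)) (suc y)
        ≡⟨ lookup-─ (false ∷ S) (closedNbhd H (suc z)) (suc y) ⟩
      lookup S y ∧ not (lookup (closedNbhd H (suc z)) (suc y))  ≡⟨ cong (λ c → lookup S y ∧ not c) (nbhd y) ⟩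
      lookup S y ∧ not (lookup (closedNbhd G z) y)              ≡⟨ lookup-─ S (closedNbhd G z) y ⟨
      lookup (S ─ closedNbhd G z) y                             ∎

  independent-lift : ∀ {S I} → Independent G S I → Independent H (false ∷ S) (false ∷ I)
  independent-lift (I⊆S , I-indep) =
    (λ { (there i∈I) → there (I⊆S i∈I) }) ,
    λ { (suc u) (suc v) (there u∈I) (there v∈I) → trans (H-restricts u v) (I-indep u v u∈I v∈I) }

  independent-restrict : ∀ {S I} → Independent H (false ∷ S) (false ∷ I) → Independent G S I
  independent-restrict (I⊆S , I-indep) =
    (drop-there ∘ I⊆S ∘ there) ,
    λ u v u∈I v∈I → trans (sym (H-restricts u v)) (I-indep (suc u) (suc v) (there u∈I) (there v∈I))

  maximal-lift : ∀ {S I} → MaximalIndependent G S I → MaximalIndependent H (false ∷ S) (false ∷ I)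
  maximal-lift {S} {I} (I-indep , I-maximal) = independent-lift I-indep , maximal
    where
    maximal : ∀ J → Independent H (false ∷ S) J → false ∷ I ⊆ J → J ⊆ false ∷ I
    maximal (true  ∷ J) (J⊆S , _) _ _ with () ← J⊆S here
    maximal (false ∷ J) J-indep I⊆J (there j∈J) =
      there (I-maximal J (independent-restrict J-indep) (drop-∷-⊆ I⊆J) j∈J)

  maximal-restrict : ∀ {S I} → MaximalIndependent H (false ∷ S) (false ∷ I) → MaximalIndependent G S I
  maximal-restrict (I-indep , I-maximal) =
    independent-restrict I-indep ,
    λ J J-indep I⊆J j∈J → drop-there (I-maximal (false ∷ J) (independent-lift J-indep)
                                                (λ { (there i∈I) → there (I⊆J i∈I) }) (there j∈J))

  wellCovered-lift : ∀ {S} → WellCovered G S → WellCovered H (false ∷ S)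
  wellCovered-lift wc (false ∷ I) (false ∷ J) I-max J-max =
    wc I J (maximal-restrict I-max) (maximal-restrict J-max)
  wellCovered-lift wc (true ∷ I) _ ((I⊆S , _) , _) _ with () ← I⊆S here
  wellCovered-lift wc _ (true ∷ J) _ ((J⊆S , _) , _) with () ← J⊆S here

  wellCovered-restrict : ∀ {S} → WellCovered H (false ∷ S) → WellCovered G S
  wellCovered-restrict wc I J I-max J-max = wc (false ∷ I) (false ∷ J) (maximal-lift I-max) (maximal-lift J-max)

  vd-lift : ∀ {S} → VertexDecomposable G S → VertexDecomposable H (false ∷ S)
  vd-lift (vd-edgeless wc edgeless) =
    vd-edgeless (wellCovered-lift wc)
      λ { (suc u) (suc v) (there u∈S) (there v∈S) → trans (H-restricts u v) (edgeless u v u∈S v∈S) }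
  vd-lift {S} (vd-shed wc z z∈S vd-S-z vd-S─Nz) =
    vd-shed (wellCovered-lift wc) (suc z) (there z∈S) (vd-lift vd-S-z)
      (subst (VertexDecomposable H) (sym (false∷-─closedNbhd S z)) (vd-lift vd-S─Nz))

  -- The index equation, instead of the index false ∷ S, keeps the recursion structural
  -- through the subst needed for closed neighbourhoods.
  vd-restrict : ∀ {T S} → VertexDecomposable H T → T ≡ false ∷ S → VertexDecomposable G S
  vd-restrict (vd-edgeless wc edgeless) refl =
    vd-edgeless (wellCovered-restrict wc)
      λ u v u∈S v∈S → trans (sym (H-restricts u v)) (edgeless (suc u) (suc v) (there u∈S) (there v∈S))
  vd-restrict (vd-shed wc (suc z) (there z∈S) vd-T-z vd-T─Nz) refl =
    vd-shed (wellCovered-restrict wc) z z∈S (vd-restrict vd-T-z refl)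
      (vd-restrict vd-T─Nz (false∷-─closedNbhd _ z))

module AddTwin {n} (G : Graph n) (x : Fin n) where

  H : Graph (suc n)
  H = addClosedNbhdVertex G x

  new~x : adj H zero (suc x) ≡ true
  new~x rewrite dec-true (x ≟ x) refl = refl

  new-twins : ∀ w → w ≢ zero → w ≢ suc x → adj H zero w ≡ adj H (suc x) w
  new-twins zero    w≢0 _   = contradiction refl w≢0
  new-twins (suc y) _   w≢x = cong (_∨ adj G x y) (dec-false (y ≟ x) (w≢x ∘ cong suc))

  open Extension G H (λ _ _ → refl)
  open AdjacentTwins H (λ ()) new~x new-twins

  vd-tail : ∀ {T} → (zero ∈ T → suc x ∈ T) → VertexDecomposable H T → VertexDecomposable G (tail T)
  vd-tail {false ∷ S} _     vd = vd-restrict vd refl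
  vd-tail {true  ∷ S} x′⇒x vd =
    vd-restrict (vd[T]⇒vd[T-a] here (x′⇒x here) vd) (cong (false ∷_) (p─⊥≡p S))

  shed-restrict : ∀ {w} → w ≢ x → ShedG H (suc w) → ShedG G w
  shed-restrict w≢x (_ , vd-H-w , vd-H─Nw) =
    ∈⊤ ,
    vd-tail (λ _ → x∈p∧x≢y⇒x∈p-y ∈⊤ (w≢x ∘ sym ∘ suc-injective)) vd-H-w ,
    vd-tail (λ x′∈ → x∈p∧x∉q⇒x∈p─q ∈⊤
                       (x∈p─q⇒x∉q x′∈ ∘ b∈closedNbhd⇒a∈closedNbhd (λ ()) (w≢x ∘ suc-injective)))
            vd-H─Nw

  vd-H : VD G → ShedG G x → VD H
  vd-H vd-G (_ , _ , vd-G─Nx) =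
    vd-shed (wellCovered[T-a]⇒wellCovered[T] here ∈⊤ (vd⇒wellCovered H vd-H-x′)) zero here
      vd-H-x′ (vd-lift vd-G─Nx)
    where
    vd-H-x′ : VertexDecomposable H (⊤ - zero)
    vd-H-x′ = subst (VertexDecomposable H) (cong (false ∷_) (sym (p─⊥≡p ⊤))) (vd-lift vd-G)

  dominating-restrict : ShedG G x → Dominating H ⊤ (ShedG H) → Dominating G ⊤ (ShedG G)
  dominating-restrict shed-x dominating v _ v∉Shed with v ≟ x
  ... | yes refl = contradiction shed-x v∉Shed
  ... | no  v≢x with dominating (suc v) ∈⊤ (v∉Shed ∘ shed-restrict v≢x)
  ...   | zero  , _      , x′~v =
    x , shed-x , trans (sym (new-twins (suc v) (λ ()) (v≢x ∘ suc-injective))) x′~v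
  -- Deciding x ≟ w rather than w ≟ x: the latter occurs in the type of shed-w (via addAdj).
  ...   | suc w , shed-w , w~v with x ≟ w
  ...     | yes refl = x , shed-x , w~v
  ...     | no  x≢w  = w , shed-restrict (x≢w ∘ sym) shed-w , w~v

theorem7p1 : ∀ {n} (G : Graph n) → VD G → ¬ Dominating G ⊤ (ShedG G)
             → (x : Fin n) → ShedG G x
             → VD (addClosedNbhdVertex G x)
               × ¬ Dominating (addClosedNbhdVertex G x) ⊤ (ShedG (addClosedNbhdVertex G x))
theorem7p1 G vd-G Shed-not-dominating x shed-x =
  vd-H vd-G shed-x , Shed-not-dominating ∘ dominating-restrict shed-x
  where open AddTwin G x
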